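{- Let $\mathcal{L}=(L,\prec_{\mathcal{L}})$ be a computable linear order of order-type $\omega$, and let $C\subseteq\mathbb{N}$ be cohesive. Then the image of the canonical embedding of $\mathcal{L}$ into $\Pi_C\mathcal{L}$ is an initial segment of $\Pi_C\mathcal{L}$ of order-type $\omega$.
   Context: A set $C\subseteq\mathbb{N}$ is cohesive if it is infinite and for every c.e. set $W$, either $C\setminus W$ or $C\cap W$ is finite. Write $X\subseteq^* Y$ if $X\setminus Y$ is finite. For a computable linear order $\mathcal{L}=(L,\prec_{\mathcal{L}})$, the cohesive power $\Pi_C\mathcal{L}$ has as elements the classes $[\varphi]$ of partial computable $\varphi\colon\mathbb{N}\to L$ with $C\subseteq^*\mathrm{dom}(\varphi)$ under $\varphi=_C\psi$ iff $C\subseteq^*\{x:\varphi(x)\downarrow=\psi(x)\downarrow\}$, ordered by $[\varphi]\prec[\psi]$ iff $C\subseteq^*\{x:\varphi(x)\downarrow,\psi(x)\downarrow,\varphi(x)\prec_{\mathcal{L}}\psi(x)\}$. The canonical embedding maps $a\in L$ to $[\psi_a]$, where $\psi_a$ is the constant function with value $a$. -}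

module Defs where

open import Data.Nat using (ℕ; zero; suc; _≤_; _<_)
open import Data.Fin using (Fin)
open import Data.Vec using (Vec; []; _∷_; lookup)
open import Data.Product using (Σ; _×_; _,_; proj₁)
open import Data.Sum using (_⊎_)
open import Relation.Nullary using (¬_)
open import Relation.Binary.PropositionalEquality using (_≡_)

-- Partial recursive functions (Kleene's μ-recursive codes) and their
-- big-step semantics.  "Partial computable" = computed by such a code.

data PR : ℕ → Set where
  zro  : ∀ {n} → PR n
  succ : PR 1
  proj : ∀ {n} → Fin n → PR n
  comp : ∀ {m n} → PR m → Vec (PR n) m → PR n
  prec : ∀ {n} → PR n → PR (suc (suc n)) → PR (suc n)
  mu   : ∀ {n} → PR (suc n) → PR n

mutual
  data Eval : ∀ {n} → PR n → Vec ℕ n → ℕ → Set where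
    ev-zro  : ∀ {n} {xs : Vec ℕ n} → Eval zro xs 0
    ev-succ : ∀ {x} → Eval succ (x ∷ []) (suc x)
    ev-proj : ∀ {n} {i : Fin n} {xs} → Eval (proj i) xs (lookup xs i)
    ev-comp : ∀ {m n} {f : PR m} {gs : Vec (PR n) m} {xs ys y} →
              EvalVec gs xs ys → Eval f ys y → Eval (comp f gs) xs y
    ev-prec0 : ∀ {n} {g : PR n} {h : PR (suc (suc n))} {xs y} →
               Eval g xs y → Eval (prec g h) (0 ∷ xs) y
    ev-precS : ∀ {n} {g : PR n} {h : PR (suc (suc n))} {k xs r y} →
               Eval (prec g h) (k ∷ xs) r → Eval h (k ∷ r ∷ xs) y →
               Eval (prec g h) (suc k ∷ xs) y
    ev-mu   : ∀ {n} {f : PR (suc n)} {xs y} →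
              MuSearch f xs 0 y → Eval (mu f) xs y

  data EvalVec {n} : ∀ {m} → Vec (PR n) m → Vec ℕ n → Vec ℕ m → Set where
    evv-[] : ∀ {xs} → EvalVec [] xs []
    evv-∷  : ∀ {m} {g : PR n} {gs : Vec (PR n) m} {xs y ys} →
             Eval g xs y → EvalVec gs xs ys → EvalVec (g ∷ gs) xs (y ∷ ys)

  data MuSearch {n} (f : PR (suc n)) (xs : Vec ℕ n) : ℕ → ℕ → Set where
    mu-found : ∀ {k} → Eval f (k ∷ xs) 0 → MuSearch f xs k k
    mu-step  : ∀ {k w y} → Eval f (k ∷ xs) (suc w) →
               MuSearch f xs (suc k) y → MuSearch f xs k y

_⟦_⟧≡_ : PR 1 → ℕ → ℕ → Set
e ⟦ x ⟧≡ y = Eval e (x ∷ []) y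

Dom : PR 1 → ℕ → Set
Dom e x = Σ ℕ λ y → e ⟦ x ⟧≡ y

Pred : Set₁
Pred = ℕ → Set

Finite : Pred → Set
Finite P = Σ ℕ λ b → ∀ x → P x → x < b

Infinite : Pred → Set
Infinite P = ∀ n → Σ ℕ λ m → n ≤ m × P m

_⊆*_ : Pred → Pred → Set
X ⊆* Y = Finite (λ x → X x × ¬ Y x)

-- c.e. sets are exactly the sets Dom e; cohesive:
Cohesive : Pred → Set
Cohesive C = Infinite C ×
  (∀ (e : PR 1) → Finite (λ x → C x × ¬ Dom e x) ⊎ Finite (λ x → C x × Dom e x))

ComputableSet : Pred → Set
ComputableSet P = Σ (PR 1) λ e → ∀ x →
  (P x × e ⟦ x ⟧≡ 1) ⊎ (¬ P x × e ⟦ x ⟧≡ 0)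

ComputableRel : (ℕ → ℕ → Set) → Set
ComputableRel R = Σ (PR 2) λ e → ∀ x y →
  (R x y × Eval e (x ∷ y ∷ []) 1) ⊎ (¬ R x y × Eval e (x ∷ y ∷ []) 0)

_⇔_ : Set → Set → Set
A ⇔ B = (A → B) × (B → A)

record CompLinOrder : Set₁ where
  field
    L       : Pred
    _≺_     : ℕ → ℕ → Set
    L-comp  : ComputableSet L
    ≺-comp  : ComputableRel _≺_
    irrefl  : ∀ {a} → L a → ¬ (a ≺ a)
    trans   : ∀ {a b c} → L a → L b → L c → a ≺ b → b ≺ c → a ≺ c
    trichot : ∀ {a b} → L a → L b → a ≺ b ⊎ a ≡ b ⊎ b ≺ a

OrderTypeω : CompLinOrder → Set
OrderTypeω 𝓛 = Σ (ℕ → ℕ) λ f →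
    (∀ a b → L a → L b → (a ≺ b) ⇔ (f a < f b))
  × (∀ n → Σ ℕ λ a → L a × f a ≡ n)
  where open CompLinOrder 𝓛

-- Cohesive power Π_C 𝓛 (as a setoid: codes with =_C and ≺_C)

module CohesivePower (𝓛 : CompLinOrder) (C : Pred) where
  open CompLinOrder 𝓛

  record Elem : Set where
    field
      code : PR 1
      dom  : C ⊆* Dom code
      into : ∀ x y → code ⟦ x ⟧≡ y → L y
  open Elem public

  _=C_ : PR 1 → PR 1 → Set
  φ =C ψ = C ⊆* (λ x → Σ ℕ λ y → φ ⟦ x ⟧≡ y × ψ ⟦ x ⟧≡ y)

  _≺C_ : PR 1 → PR 1 → Set
  φ ≺C ψ = C ⊆* (λ x → Σ ℕ λ y → Σ ℕ λ z → φ ⟦ x ⟧≡ y × ψ ⟦ x ⟧≡ z × y ≺ z)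

  const : ℕ → PR 1
  const zero    = zro
  const (suc a) = comp succ (const a ∷ [])

  InImage : Elem → Set
  InImage φ = Σ ℕ λ a → L a × (code φ =C const a)

  ImageElem : Set
  ImageElem = Σ Elem InImage

  IsInitialSegment : Set
  IsInitialSegment = ∀ (φ : Elem) (ψ : ImageElem) →
    code φ ≺C code (proj₁ ψ) → InImage φ

  ImageOrderTypeω : Set
  ImageOrderTypeω = Σ (ImageElem → ℕ) λ g →
      (∀ p q → (code (proj₁ p) =C code (proj₁ q)) ⇔ (g p ≡ g q))
    × (∀ p q → (code (proj₁ p) ≺C code (proj₁ q)) ⇔ (g p < g q))
    × (∀ n → Σ ImageElem λ p → g p ≡ n)

-- For a partial computable φ and a ∈ L the fibre φ⁻¹(a) is c.e., so
-- cohesiveness of C forces either φ =_C ψ_a or C ∩ φ⁻¹(a) finite. If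
-- [φ] lies below [ψ_b], then almost every x ∈ C is mapped by φ to one of
-- the finitely many predecessors of b in L (here the order type ω is
-- used); these fibres cannot all meet C finitely, so φ =_C ψ_a for one of
-- them. On the image, [ψ_a] ↦ rank of a is an isomorphism onto ω, since a
-- relation between constants holding on almost all of the infinite set C
-- holds outright.
module Submission where

open import Defs
open import Data.Nat using (ℕ; zero; suc; _<_; _∸_; pred; _+_; _<?_)
open import Data.Nat.Properties
open import Data.Fin using () renaming (zero to fzero; suc to fsuc)
open import Data.Vec using (Vec; []; _∷_)
open import Data.Product using (Σ; _×_; _,_; proj₁; proj₂)
open import Data.Sum using (_⊎_; inj₁; inj₂)
open import Data.Empty using (⊥-elim)
open import Relation.Nullary using (¬_; Dec; yes; no)
open import Relation.Nullary.Decidable using (decidable-stable)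
open import Relation.Unary using (_∩_; _∪_; _⊆_)
open import Relation.Binary.PropositionalEquality

mutual
  Eval-deterministic : ∀ {n} {f : PR n} {xs y y′} →
                       Eval f xs y → Eval f xs y′ → y ≡ y′
  Eval-deterministic ev-zro ev-zro = refl
  Eval-deterministic ev-succ ev-succ = refl
  Eval-deterministic ev-proj ev-proj = refl
  Eval-deterministic (ev-comp gs f) (ev-comp gs′ f′)
    rewrite EvalVec-deterministic gs gs′ = Eval-deterministic f f′
  Eval-deterministic (ev-prec0 g) (ev-prec0 g′) = Eval-deterministic g g′
  Eval-deterministic (ev-precS r h) (ev-precS r′ h′)
    rewrite Eval-deterministic r r′ = Eval-deterministic h h′
  Eval-deterministic (ev-mu s) (ev-mu s′) = MuSearch-deterministic s s′

  EvalVec-deterministic : ∀ {n m} {gs : Vec (PR n) m} {xs ys ys′} →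
                          EvalVec gs xs ys → EvalVec gs xs ys′ → ys ≡ ys′
  EvalVec-deterministic evv-[] evv-[] = refl
  EvalVec-deterministic (evv-∷ g gs) (evv-∷ g′ gs′) =
    cong₂ _∷_ (Eval-deterministic g g′) (EvalVec-deterministic gs gs′)

  MuSearch-deterministic : ∀ {n} {f : PR (suc n)} {xs k y y′} →
                           MuSearch f xs k y → MuSearch f xs k y′ → y ≡ y′
  MuSearch-deterministic (mu-found _) (mu-found _) = refl
  MuSearch-deterministic (mu-found f0) (mu-step fs _)
    with () ← Eval-deterministic f0 fs
  MuSearch-deterministic (mu-step fs _) (mu-found f0)
    with () ← Eval-deterministic fs f0
  MuSearch-deterministic (mu-step _ s) (mu-step _ s′) = MuSearch-deterministic s s′

MuSearch-zero : ∀ {n} {f : PR (suc n)} {xs k y} → MuSearch f xs k y → Eval f (y ∷ xs) 0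
MuSearch-zero (mu-found f0) = f0
MuSearch-zero (mu-step _ s) = MuSearch-zero s

constPR : ∀ {n} → ℕ → PR n
constPR zero    = zro
constPR (suc a) = comp succ (constPR a ∷ [])

constPR-eval : ∀ {n} a {xs : Vec ℕ n} → Eval (constPR a) xs a
constPR-eval zero    = ev-zro
constPR-eval (suc a) = ev-comp (evv-∷ (constPR-eval a) evv-[]) ev-succ

predPR : PR 1
predPR = prec zro (proj fzero)

predPR-eval : ∀ x → predPR ⟦ x ⟧≡ pred x
predPR-eval zero    = ev-prec0 ev-zro
predPR-eval (suc x) = ev-precS (predPR-eval x) ev-proj

subPR : ℕ → PR 1
subPR zero    = proj fzero
subPR (suc a) = comp predPR (subPR a ∷ [])

subPR-eval : ∀ a x → subPR a ⟦ x ⟧≡ (x ∸ a)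
subPR-eval zero    x = ev-proj
subPR-eval (suc a) x = subst (subPR (suc a) ⟦ x ⟧≡_) (pred[m∸n]≡m∸[1+n] x a)
  (ev-comp (evv-∷ (subPR-eval a x) evv-[]) (predPR-eval (x ∸ a)))

subFromPR : ℕ → PR 1
subFromPR a = prec (constPR a) (comp predPR (proj (fsuc fzero) ∷ []))

subFromPR-eval : ∀ a x → subFromPR a ⟦ x ⟧≡ (a ∸ x)
subFromPR-eval a zero    = ev-prec0 (constPR-eval a)
subFromPR-eval a (suc x) = subst (subFromPR a ⟦ suc x ⟧≡_) (pred[m∸n]≡m∸[1+n] a x)
  (ev-precS (subFromPR-eval a x) (ev-comp (evv-∷ ev-proj evv-[]) (predPR-eval (a ∸ x))))

-- μk. D(x): the search ignores k, so it halts (at k = 0) exactly when D(x) = 0.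
haltsOnZeroPR : PR 1 → PR 1
haltsOnZeroPR D = mu (comp D (proj (fsuc fzero) ∷ []))

haltsOnZeroPR-sound : ∀ D {x r t} → D ⟦ x ⟧≡ r → haltsOnZeroPR D ⟦ x ⟧≡ t → r ≡ 0
haltsOnZeroPR-sound D Dx (ev-mu s) with MuSearch-zero s
... | ev-comp (evv-∷ ev-proj evv-[]) Dx0 = Eval-deterministic Dx Dx0

haltsOnZeroPR-complete : ∀ D {x} → D ⟦ x ⟧≡ 0 → haltsOnZeroPR D ⟦ x ⟧≡ 0
haltsOnZeroPR-complete D Dx0 = ev-mu (mu-found (ev-comp (evv-∷ ev-proj evv-[]) Dx0))

-- halts on x iff x ∸ a = 0 and a ∸ x = 0
isPR : ℕ → PR 1
isPR a = comp zro (haltsOnZeroPR (subPR a) ∷ haltsOnZeroPR (subFromPR a) ∷ [])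

Dom-isPR : ∀ a {x} → Dom (isPR a) x ⇔ (x ≡ a)
Dom-isPR a {x} = sound , complete
  where
  sound : Dom (isPR a) x → x ≡ a
  sound (_ , ev-comp (evv-∷ h₁ (evv-∷ h₂ evv-[])) _) = ≤-antisym
    (m∸n≡0⇒m≤n (haltsOnZeroPR-sound (subPR a) (subPR-eval a x) h₁))
    (m∸n≡0⇒m≤n (haltsOnZeroPR-sound (subFromPR a) (subFromPR-eval a x) h₂))

  halts-at-a : ∀ D → D ⟦ a ⟧≡ (a ∸ a) → haltsOnZeroPR D ⟦ a ⟧≡ 0
  halts-at-a D Da = haltsOnZeroPR-complete D (subst (D ⟦ a ⟧≡_) (n∸n≡0 a) Da)

  complete : x ≡ a → Dom (isPR a) x
  complete refl = 0 , ev-comp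
    (evv-∷ (halts-at-a (subPR a) (subPR-eval a a))
      (evv-∷ (halts-at-a (subFromPR a) (subFromPR-eval a a)) evv-[]))
    ev-zro

Fibre : PR 1 → ℕ → Pred
Fibre φ a x = φ ⟦ x ⟧≡ a

fibrePR : PR 1 → ℕ → PR 1
fibrePR φ a = comp (isPR a) (φ ∷ [])

Dom-fibrePR : ∀ φ a {x} → Dom (fibrePR φ a) x ⇔ Fibre φ a x
Dom-fibrePR φ a {x} = sound , complete
  where
  sound : Dom (fibrePR φ a) x → Fibre φ a x
  sound (t , ev-comp (evv-∷ φx evv-[]) isa) =
    subst (φ ⟦ x ⟧≡_) (proj₁ (Dom-isPR a) (t , isa)) φx

  complete : Fibre φ a x → Dom (fibrePR φ a) x
  complete φx with t , isa ← proj₂ (Dom-isPR a) refl = t , ev-comp (evv-∷ φx evv-[]) isa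

Finite-⊆ : ∀ {P Q : Pred} → P ⊆ Q → Finite Q → Finite P
Finite-⊆ P⊆Q (b , Q<b) = b , λ x Px → Q<b x (P⊆Q Px)

Finite-∪ : ∀ {P Q : Pred} → Finite P → Finite Q → Finite (P ∪ Q)
Finite-∪ (b , P<b) (c , Q<c) = b + c , λ where
  x (inj₁ Px) → <-≤-trans (P<b x Px) (m≤m+n b c)
  x (inj₂ Qx) → <-≤-trans (Q<c x Qx) (m≤n+m c b)

⊆*-map : ∀ {X Y Z : Pred} → X ⊆* Y → Y ⊆ Z → X ⊆* Z
⊆*-map (b , below) Y⊆Z = b , λ x (Xx , ¬Zx) → below x (Xx , λ Yx → ¬Zx (Y⊆Z Yx))

-- Membership in Y ∩ Z is not decidable; comparing x with the bound is.
⊆*-∩ : ∀ {X Y Z : Pred} → X ⊆* Y → X ⊆* Z → X ⊆* (Y ∩ Z)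
⊆*-∩ {X} {Y} {Z} (b , Y-below) (c , Z-below) = b + c , below
  where
  below : ∀ x → X x × ¬ (Y ∩ Z) x → x < b + c
  below x (Xx , ¬YZx) with x <? b + c
  ... | yes x<b+c = x<b+c
  ... | no  x≮b+c = ⊥-elim (¬¬Yx λ Yx → ¬¬Zx λ Zx → ¬YZx (Yx , Zx))
    where
    ¬¬Yx : ¬ ¬ Y x
    ¬¬Yx ¬Yx = x≮b+c (<-≤-trans (Y-below x (Xx , ¬Yx)) (m≤m+n b c))
    ¬¬Zx : ¬ ¬ Z x
    ¬¬Zx ¬Zx = x≮b+c (<-≤-trans (Z-below x (Xx , ¬Zx)) (m≤n+m c b))

Infinite-⊆*⇒¬Finite-∩ : ∀ {X Y : Pred} → Infinite X → X ⊆* Y → ¬ Finite (X ∩ Y)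
Infinite-⊆*⇒¬Finite-∩ {Y = Y} inf (b , ¬Y-below) (c , Y-below) with inf (b + c)
... | x , b+c≤x , Xx = ¬¬Yx λ Yx → <⇒≱ (Y-below x (Xx , Yx)) (≤-trans (m≤n+m c b) b+c≤x)
  where
  ¬¬Yx : ¬ ¬ Y x
  ¬¬Yx ¬Yx = <⇒≱ (¬Y-below x (Xx , ¬Yx)) (≤-trans (m≤m+n b c) b+c≤x)

Infinite-⊆*-const : ∀ {X : Pred} {P : Set} → Infinite X → Dec P → X ⊆* (λ _ → P) → P
Infinite-⊆*-const inf P? X⊆*P = decidable-stable P? λ ¬P →
  Infinite-⊆*⇒¬Finite-∩ inf X⊆*P (0 , λ _ (_ , p) → ⊥-elim (¬P p))

Cohesive-fibre : ∀ {C : Pred} → Cohesive C → ∀ φ a →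
                 C ⊆* Fibre φ a ⊎ Finite (C ∩ Fibre φ a)
Cohesive-fibre (_ , cohesive) φ a with cohesive (fibrePR φ a)
... | inj₁ C⊆*Dom = inj₁ (⊆*-map C⊆*Dom (proj₁ (Dom-fibrePR φ a)))
... | inj₂ C∩Dom-finite =
  inj₂ (Finite-⊆ (λ (Cx , φx) → Cx , proj₂ (Dom-fibrePR φ a) φx) C∩Dom-finite)

module _ (𝓛 : CompLinOrder) where
  open CompLinOrder 𝓛 using (L; _≺_; trichot)

  ≺-embedding-injective : {f : ℕ → ℕ} → (∀ a b → L a → L b → (a ≺ b) ⇔ (f a < f b)) →
                          ∀ {a b} → L a → L b → f a ≡ f b → a ≡ b
  ≺-embedding-injective {f} embed {a} {b} La Lb fa≡fb with trichot La Lb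
  ... | inj₁ a≺b        = ⊥-elim (<-irrefl fa≡fb (proj₁ (embed a b La Lb) a≺b))
  ... | inj₂ (inj₁ a≡b) = a≡b
  ... | inj₂ (inj₂ b≺a) = ⊥-elim (<-irrefl (sym fa≡fb) (proj₁ (embed b a Lb La) b≺a))

  module _ (C : Pred) where
    open CohesivePower 𝓛 C

    const-eval : ∀ a x → const a ⟦ x ⟧≡ a
    const-eval zero    x = ev-zro
    const-eval (suc a) x = ev-comp (evv-∷ (const-eval a x) evv-[]) ev-succ

    =C-const⇔⊆*-Fibre : ∀ {φ a} → (φ =C const a) ⇔ (C ⊆* Fibre φ a)
    =C-const⇔⊆*-Fibre {φ} {a} = to , from
      where
      to : φ =C const a → C ⊆* Fibre φ a
      to φ=a = ⊆*-map φ=a λ {x} (y , φx , ψx) →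
        subst (φ ⟦ x ⟧≡_) (Eval-deterministic ψx (const-eval a x)) φx

      from : C ⊆* Fibre φ a → φ =C const a
      from C⊆*φa = ⊆*-map C⊆*φa λ {x} φx → a , φx , const-eval a x

    constElem : ∀ {a} → L a → Elem
    constElem {a} La = record
      { code = const a
      ; dom  = 0 , λ x (_ , ¬dom) → ⊥-elim (¬dom (a , const-eval a x))
      ; into = λ x y ψx → subst L (Eval-deterministic (const-eval a x) ψx) La
      }

    constElem-inImage : ∀ {a} (La : L a) → InImage (constElem La)
    constElem-inImage {a} La = a , La , proj₂ =C-const⇔⊆*-Fibre
      (0 , λ x (_ , ¬ψx) → ⊥-elim (¬ψx (const-eval a x)))

    isInitialSegment : OrderTypeω 𝓛 → Cohesive C → IsInitialSegment
    isInitialSegment (f , embed , onto) cohesive@(infinite , _) φ (ψ , b , Lb , ψ=b) φ≺ψ =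
      conclude (imageOrFiniteBelow (f b))
      where
      RankBelow : ℕ → Pred
      RankBelow n x = Σ ℕ λ y → code φ ⟦ x ⟧≡ y × L y × f y < n

      C⊆*RankBelow-b : C ⊆* RankBelow (f b)
      C⊆*RankBelow-b =
        ⊆*-map (⊆*-∩ φ≺ψ (proj₁ =C-const⇔⊆*-Fibre ψ=b)) λ {x} ((y , z , φx , ψx , y≺z) , ψb) →
          let Ly = into φ x y φx
          in y , φx , Ly , proj₁ (embed y b Ly Lb) (subst (y ≺_) (Eval-deterministic ψx ψb) y≺z)

      imageOrFiniteBelow : ∀ n → InImage φ ⊎ Finite (C ∩ RankBelow n)
      imageOrFiniteBelow zero = inj₂ (0 , λ where _ (_ , _ , _ , _ , ()))
      imageOrFiniteBelow (suc n) with imageOrFiniteBelow n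
      ... | inj₁ inImage = inj₁ inImage
      ... | inj₂ below-n-finite with a , La , fa≡n ← onto n
            with Cohesive-fibre cohesive (code φ) a
      ... | inj₁ C⊆*φa = inj₁ (a , La , proj₂ =C-const⇔⊆*-Fibre C⊆*φa)
      ... | inj₂ φa-finite = inj₂ (Finite-⊆ split (Finite-∪ below-n-finite φa-finite))
        where
        split : C ∩ RankBelow (suc n) ⊆ (C ∩ RankBelow n) ∪ (C ∩ Fibre (code φ) a)
        split {x} (Cx , y , φx , Ly , fy<1+n) with m<1+n⇒m<n∨m≡n fy<1+n
        ... | inj₁ fy<n = inj₁ (Cx , y , φx , Ly , fy<n)
        ... | inj₂ fy≡n = inj₂ (Cx , subst (code φ ⟦ x ⟧≡_)
                (≺-embedding-injective embed Ly La (trans fy≡n (sym fa≡n))) φx)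

      conclude : InImage φ ⊎ Finite (C ∩ RankBelow (f b)) → InImage φ
      conclude (inj₁ inImage) = inImage
      conclude (inj₂ below-b-finite) =
        ⊥-elim (Infinite-⊆*⇒¬Finite-∩ infinite C⊆*RankBelow-b below-b-finite)

    imageOrderTypeω : OrderTypeω 𝓛 → Infinite C → ImageOrderTypeω
    imageOrderTypeω (f , embed , onto) infinite = rank , =C⇔≡ , ≺C⇔< , rank-onto
      where
      rank : ImageElem → ℕ
      rank (_ , a , _) = f a

      =C⇔≡ : ∀ p q → (code (proj₁ p) =C code (proj₁ q)) ⇔ (rank p ≡ rank q)
      =C⇔≡ (φ , a , La , φ=a) (ψ , b , Lb , ψ=b) = to , from
        where
        φa : C ⊆* Fibre (code φ) a
        φa = proj₁ =C-const⇔⊆*-Fibre φ=a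
        ψb : C ⊆* Fibre (code ψ) b
        ψb = proj₁ =C-const⇔⊆*-Fibre ψ=b

        to : code φ =C code ψ → f a ≡ f b
        to φ=ψ = cong f (Infinite-⊆*-const infinite (a ≟ b)
          (⊆*-map (⊆*-∩ (⊆*-∩ φa φ=ψ) ψb) λ ((φx , y , φx′ , ψx) , ψx′) →
            trans (Eval-deterministic φx φx′) (Eval-deterministic ψx ψx′)))

        from : f a ≡ f b → code φ =C code ψ
        from fa≡fb with refl ← ≺-embedding-injective embed La Lb fa≡fb =
          ⊆*-map (⊆*-∩ φa ψb) λ (φx , ψx) → a , φx , ψx

      ≺C⇔< : ∀ p q → (code (proj₁ p) ≺C code (proj₁ q)) ⇔ (rank p < rank q)
      ≺C⇔< (φ , a , La , φ=a) (ψ , b , Lb , ψ=b) = to , from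
        where
        φa : C ⊆* Fibre (code φ) a
        φa = proj₁ =C-const⇔⊆*-Fibre φ=a
        ψb : C ⊆* Fibre (code ψ) b
        ψb = proj₁ =C-const⇔⊆*-Fibre ψ=b

        to : code φ ≺C code ψ → f a < f b
        to φ≺ψ = Infinite-⊆*-const infinite (f a <? f b)
          (⊆*-map (⊆*-∩ (⊆*-∩ φa φ≺ψ) ψb) λ ((φx , y , z , φx′ , ψx , y≺z) , ψx′) →
            proj₁ (embed a b La Lb)
              (subst₂ _≺_ (Eval-deterministic φx′ φx) (Eval-deterministic ψx ψx′) y≺z))

        from : f a < f b → code φ ≺C code ψ
        from fa<fb = ⊆*-map (⊆*-∩ φa ψb) λ (φx , ψx) →
          a , b , φx , ψx , proj₂ (embed a b La Lb) fa<fb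

      rank-onto : ∀ n → Σ ImageElem λ p → rank p ≡ n
      rank-onto n with a , La , fa≡n ← onto n = (constElem La , constElem-inImage La) , fa≡n

lemma4p1 : (𝓛 : CompLinOrder) → OrderTypeω 𝓛 → (C : Pred) → Cohesive C →
    CohesivePower.IsInitialSegment 𝓛 C × CohesivePower.ImageOrderTypeω 𝓛 C
lemma4p1 𝓛 ω C cohesive@(infinite , _) =
  isInitialSegment 𝓛 C ω cohesive , imageOrderTypeω 𝓛 C ω infinite
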